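{- For any nonnegative integers $n$ and $r$, \[ \tilde{w}_{n,r}=\sum_{k=r}^{n}\binom{n}{k}{k\brace r}\tilde{w}_{n-k}. \]
   Context: ${n\brace k}$ denotes the Stirling number of the second kind. $d_{k,r}$ is the number of permutations of a $k$-set with exactly $r$ fixed points ($d_{k,r}=\binom{k}{r}d_{k-r}$ for $k\ge r$, $0$ otherwise, with $d_m=m!\sum_{i=0}^m(-1)^i/i!$ the derangement numbers). The partial deranged Bell numbers are $\tilde{w}_{n,r}=\sum_{k=0}^n{n\brace k}d_{k,r}$ (the number of set partitions of $[n]$ together with a permutation of the blocks fixing exactly $r$ blocks), and the deranged Bell numbers are $\tilde{w}_n=\tilde{w}_{n,0}=\sum_{k=0}^n{n\brace k}d_k$. -}

module Defs where

open import Data.Nat using (_≤ᵇ_; ℕ; zero; suc; _+_; _*_; _∸_)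
open import Data.Nat.Combinatorics using (_C_; _P_)
open import Data.Bool using (true; false)
open import Data.Integer using (ℤ; +_; -_) renaming (_+_ to _+ℤ_; _*_ to _*ℤ_)

sumTo : {A : Set} → (A → A → A) → A → ℕ → (ℕ → A) → A
sumTo _⊕_ e zero    f = e ⊕ f 0
sumTo _⊕_ e (suc n) f = sumTo _⊕_ e n f ⊕ f (suc n)

sumℕ : ℕ → (ℕ → ℕ) → ℕ
sumℕ = sumTo _+_ 0

sumℤ : ℕ → (ℕ → ℤ) → ℤ
sumℤ = sumTo _+ℤ_ (+ 0)

S2 : ℕ → ℕ → ℕ
S2 zero    zero    = 1
S2 zero    (suc k) = 0
S2 (suc n) zero    = 0
S2 (suc n) (suc k) = suc k * S2 n (suc k) + S2 n k

sgn : ℕ → ℤ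
sgn zero    = + 1
sgn (suc i) = - sgn i

-- derangement number d_m = m! Σ_{i=0}^m (-1)^i / i!  =  Σ_{i=0}^m (-1)^i m!/i!,
-- where m!/i! = m P (m ∸ i) (falling factorial) for i ≤ m.  Computed in ℤ.
derangeℤ : ℕ → ℤ
derangeℤ m = sumℤ m (λ i → sgn i *ℤ (+ (m P (m ∸ i))))

dkr : ℕ → ℕ → ℤ
dkr k r with r ≤ᵇ k
... | true  = + (k C r) *ℤ derangeℤ (k ∸ r)
... | false = + 0

wPartial : ℕ → ℕ → ℤ
wPartial n r = sumℤ n (λ k → + S2 n k *ℤ dkr k r)

wDeranged : ℕ → ℤ
wDeranged n = wPartial n 0

sumFromTo : ℕ → ℕ → (ℕ → ℤ) → ℤ
sumFromTo r n f with r ≤ᵇ n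
... | true  = sumℤ (n ∸ r) (λ j → f (r + j))
... | false = + 0

{-# OPTIONS --safe #-}
module Submission where

-- Write c(n,r,j) = Σ_k C(n,k) S(k,r) S(n−k,j).  Expanding w̃_{n−k} = Σ_j S(n−k,j) d_j and
-- exchanging the sums turns the right-hand side into Σ_j c(n,r,j) d_j.  On the left,
-- d_{k,r} = C(k,r) d_{k−r} gives Σ_j C(r+j,r) S(n,r+j) d_j, and the two agree by the
-- Stirling convolution identity c(n,r,j) = C(r+j,r) S(n,r+j) (a partition into r+j blocks,
-- r of them marked, is a partition of a k-subset into r blocks and of its complement into
-- j blocks).  That identity follows by induction on n from the Leibniz rule for binomial
-- convolution and the recurrence S(k+1,r) = r S(k,r) + S(k,r−1).

open import Defs
open import Level using (0ℓ)
open import Algebra.Bundles using (CommutativeSemiring)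
open import Data.Bool using (true; false; T)
open import Data.Empty using (⊥-elim)
open import Data.Nat using (ℕ; zero; suc; _∸_; _≤_; _<_; z≤n; s≤s; _≤ᵇ_) renaming (_*_ to _*ℕ_)
import Data.Nat as N
import Data.Nat.Properties as NP
open import Data.Nat.Combinatorics using (_C_; nCk+nC[k+1]≡[n+1]C[k+1]; k>n⇒nCk≡0; nCn≡1)
open import Data.Unit using (tt)
open import Function using (_∘_)

module SumTo {ℓ} (R : CommutativeSemiring 0ℓ ℓ) where

  open CommutativeSemiring R
  open import Algebra.Properties.CommutativeSemigroup +-commutativeSemigroup
    using (interchange)
  open import Relation.Binary.Reasoning.Setoid setoid

  Σ : ℕ → (ℕ → Carrier) → Carrier
  Σ = sumTo _+_ 0#

  Σ-cong : ∀ n {f g : ℕ → Carrier} → (∀ k → k ≤ n → f k ≈ g k) → Σ n f ≈ Σ n g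
  Σ-cong zero    f≈g = +-congˡ (f≈g 0 z≤n)
  Σ-cong (suc n) f≈g =
    +-cong (Σ-cong n (λ k k≤n → f≈g k (NP.m≤n⇒m≤1+n k≤n))) (f≈g (suc n) NP.≤-refl)

  Σ-zeros : ∀ n {f : ℕ → Carrier} → (∀ k → k ≤ n → f k ≈ 0#) → Σ n f ≈ 0#
  Σ-zeros zero    f≈0 = trans (+-congˡ (f≈0 0 z≤n)) (+-identityˡ 0#)
  Σ-zeros (suc n) f≈0 = trans
    (+-cong (Σ-zeros n (λ k k≤n → f≈0 k (NP.m≤n⇒m≤1+n k≤n))) (f≈0 (suc n) NP.≤-refl))
    (+-identityˡ 0#)

  Σ-distrib-+ : ∀ n (f g : ℕ → Carrier) → Σ n (λ k → f k + g k) ≈ Σ n f + Σ n g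
  Σ-distrib-+ zero    f g = trans (+-identityˡ _) (sym (+-cong (+-identityˡ _) (+-identityˡ _)))
  Σ-distrib-+ (suc n) f g = trans (+-congʳ (Σ-distrib-+ n f g)) (interchange _ _ _ _)

  *-distribˡ-Σ : ∀ n a (f : ℕ → Carrier) → a * Σ n f ≈ Σ n (λ k → a * f k)
  *-distribˡ-Σ zero    a f = trans (distribˡ a 0# (f 0)) (+-congʳ (zeroʳ a))
  *-distribˡ-Σ (suc n) a f = trans (distribˡ a _ _) (+-congʳ (*-distribˡ-Σ n a f))

  *-distribʳ-Σ : ∀ n a (f : ℕ → Carrier) → Σ n f * a ≈ Σ n (λ k → f k * a)
  *-distribʳ-Σ n a f = begin
    Σ n f * a              ≈⟨ *-comm _ a ⟩
    a * Σ n f              ≈⟨ *-distribˡ-Σ n a f ⟩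
    Σ n (λ k → a * f k)    ≈⟨ Σ-cong n (λ k _ → *-comm a (f k)) ⟩
    Σ n (λ k → f k * a)    ∎

  Σ-unfoldˡ : ∀ n (f : ℕ → Carrier) → Σ (suc n) f ≈ f 0 + Σ n (λ k → f (suc k))
  Σ-unfoldˡ zero    f = trans (+-congʳ (+-identityˡ (f 0))) (+-congˡ (sym (+-identityˡ (f 1))))
  Σ-unfoldˡ (suc n) f = trans (+-congʳ (Σ-unfoldˡ n f)) (+-assoc _ _ _)

  Σ-dropˡ : ∀ r n (f : ℕ → Carrier) → (∀ k → k < r → f k ≈ 0#) →
            Σ (r N.+ n) f ≈ Σ n (λ j → f (r N.+ j))
  Σ-dropˡ zero    n f f≈0 = refl
  Σ-dropˡ (suc r) n f f≈0 = begin
    Σ (suc (r N.+ n)) f                 ≈⟨ Σ-unfoldˡ (r N.+ n) f ⟩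
    f 0 + Σ (r N.+ n) (λ k → f (suc k)) ≈⟨ +-congʳ (f≈0 0 (s≤s z≤n)) ⟩
    0# + Σ (r N.+ n) (λ k → f (suc k))  ≈⟨ +-identityˡ _ ⟩
    Σ (r N.+ n) (λ k → f (suc k))       ≈⟨ Σ-dropˡ r n (λ k → f (suc k)) (λ k k<r → f≈0 (suc k) (s≤s k<r)) ⟩
    Σ n (λ j → f (suc r N.+ j))         ∎

  Σ-dropʳ : ∀ b n (f : ℕ → Carrier) → (∀ k → n < k → f k ≈ 0#) → Σ (b N.+ n) f ≈ Σ n f
  Σ-dropʳ zero    n f f≈0 = refl
  Σ-dropʳ (suc b) n f f≈0 =
    trans (+-cong (Σ-dropʳ b n f f≈0) (f≈0 _ (s≤s (NP.m≤n+m n b)))) (+-identityʳ _)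

  Σ-swap : ∀ a b (g : ℕ → ℕ → Carrier) →
           Σ a (λ i → Σ b (g i)) ≈ Σ b (λ j → Σ a (λ i → g i j))
  Σ-swap zero    b g = trans (+-identityˡ _) (Σ-cong b (λ j _ → sym (+-identityˡ _)))
  Σ-swap (suc a) b g = trans (+-congʳ (Σ-swap a b g)) (sym (Σ-distrib-+ b _ _))

open import Relation.Binary.PropositionalEquality using (_≡_; refl; sym; trans; cong; cong₂; subst; module ≡-Reasoning)

module StirlingConvolution where

  open import Data.Nat using (_+_; _*_)
  open import Data.Nat.Solver using (module +-*-Solver)
  open +-*-Solver using (solve; _:+_; _:*_; _:=_)

  module ΣN = SumTo NP.+-*-commutativeSemiring

  _⋆_ : (ℕ → ℕ) → (ℕ → ℕ) → ℕ → ℕ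
  (f ⋆ g) n = sumℕ n (λ k → (n C k) * f k * g (n ∸ k))

  ⋆-cong : ∀ n {f f′ g g′ : ℕ → ℕ} → (∀ k → f k ≡ f′ k) → (∀ k → g k ≡ g′ k) →
           (f ⋆ g) n ≡ (f′ ⋆ g′) n
  ⋆-cong n f≡f′ g≡g′ = ΣN.Σ-cong n (λ k _ → cong₂ (λ x y → (n C k) * x * y) (f≡f′ k) (g≡g′ (n ∸ k)))

  -- Pascal's rule splits each term of the left sum; the second halves are the terms
  -- k ≥ 1 of (f ⋆ (g ∘ suc)) n, whose k = 0 term is the one left over.
  ⋆-leibniz : ∀ n (f g : ℕ → ℕ) → (f ⋆ g) (suc n) ≡ ((f ∘ suc) ⋆ g) n + (f ⋆ (g ∘ suc)) n
  ⋆-leibniz n f g = begin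
    Σ (suc n) F                      ≡⟨ Σ-unfoldˡ n F ⟩
    F 0 + Σ n (F ∘ suc)              ≡⟨ cong (F 0 +_) (Σ-cong n (λ k _ → pascal k)) ⟩
    F 0 + Σ n (λ k → a k + b k)      ≡⟨ cong (F 0 +_) (Σ-distrib-+ n a b) ⟩
    F 0 + (Σ n a + Σ n b)            ≡⟨ x∙yz≈y∙xz (F 0) (Σ n a) (Σ n b) ⟩
    Σ n a + (G 0 + Σ n (G ∘ suc))    ≡⟨ cong (Σ n a +_) (sym (Σ-unfoldˡ n G)) ⟩
    Σ n a + Σ (1 + n) G              ≡⟨ cong (Σ n a +_) (Σ-dropʳ 1 n G G-vanishes) ⟩
    Σ n a + Σ n G                    ≡⟨ cong (Σ n a +_) (Σ-cong n (λ k k≤n →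
                                          cong (λ m → (n C k) * f k * g m) (NP.+-∸-assoc 1 k≤n))) ⟩
    Σ n a + (f ⋆ (g ∘ suc)) n        ∎
    where
    open ≡-Reasoning
    open ΣN
    open import Algebra.Properties.CommutativeSemigroup NP.+-commutativeSemigroup using (x∙yz≈y∙xz)
    F a b G : ℕ → ℕ
    F k = (suc n C k) * f k * g (suc n ∸ k)
    a k = (n C k) * f (suc k) * g (n ∸ k)
    b k = (n C suc k) * f (suc k) * g (n ∸ k)
    G k = (n C k) * f k * g (suc n ∸ k)
    pascal : ∀ k → F (suc k) ≡ a k + b k
    pascal k = begin
      (suc n C suc k) * f (suc k) * g (n ∸ k)   ≡⟨ cong (λ c → c * f (suc k) * g (n ∸ k)) (sym (nCk+nC[k+1]≡[n+1]C[k+1] n k)) ⟩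
      (n C k + n C suc k) * f (suc k) * g (n ∸ k) ≡⟨ solve 4 (λ c c′ x y → (c :+ c′) :* x :* y := c :* x :* y :+ c′ :* x :* y)
                                                      refl (n C k) (n C suc k) (f (suc k)) (g (n ∸ k)) ⟩
      a k + b k                                  ∎
    G-vanishes : ∀ k → n < k → G k ≡ 0
    G-vanishes k n<k = cong (λ c → c * f k * g (suc n ∸ k)) (k>n⇒nCk≡0 n<k)

  ⋆-linearˡ : ∀ n c (f h g : ℕ → ℕ) → ((λ k → c * f k + h k) ⋆ g) n ≡ c * (f ⋆ g) n + (h ⋆ g) n
  ⋆-linearˡ n c f h g = begin
    Σ n (λ k → (n C k) * (c * f k + h k) * g (n ∸ k))
      ≡⟨ Σ-cong n (λ k _ → solve 5 (λ c b x y z → b :* (c :* x :+ y) :* z := c :* (b :* x :* z) :+ b :* y :* z)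
                             refl c (n C k) (f k) (h k) (g (n ∸ k))) ⟩
    Σ n (λ k → c * ((n C k) * f k * g (n ∸ k)) + (n C k) * h k * g (n ∸ k))
      ≡⟨ Σ-distrib-+ n _ _ ⟩
    Σ n (λ k → c * ((n C k) * f k * g (n ∸ k))) + (h ⋆ g) n
      ≡⟨ cong (_+ (h ⋆ g) n) (sym (*-distribˡ-Σ n c _)) ⟩
    c * (f ⋆ g) n + (h ⋆ g) n ∎
    where
    open ≡-Reasoning
    open ΣN

  ⋆-linearʳ : ∀ n c (f g h : ℕ → ℕ) → (f ⋆ (λ k → c * g k + h k)) n ≡ c * (f ⋆ g) n + (f ⋆ h) n
  ⋆-linearʳ n c f g h = begin
    Σ n (λ k → (n C k) * f k * (c * g (n ∸ k) + h (n ∸ k)))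
      ≡⟨ Σ-cong n (λ k _ → solve 5 (λ c b x y z → b :* x :* (c :* y :+ z) := c :* (b :* x :* y) :+ b :* x :* z)
                             refl c (n C k) (f k) (g (n ∸ k)) (h (n ∸ k))) ⟩
    Σ n (λ k → c * ((n C k) * f k * g (n ∸ k)) + (n C k) * f k * h (n ∸ k))
      ≡⟨ Σ-distrib-+ n _ _ ⟩
    Σ n (λ k → c * ((n C k) * f k * g (n ∸ k))) + (f ⋆ h) n
      ≡⟨ cong (_+ (f ⋆ h) n) (sym (*-distribˡ-Σ n c _)) ⟩
    c * (f ⋆ g) n + (f ⋆ h) n ∎
    where
    open ≡-Reasoning
    open ΣN

  ⋆-zeroˡ : ∀ n (g : ℕ → ℕ) → ((λ _ → 0) ⋆ g) n ≡ 0
  ⋆-zeroˡ n g = ΣN.Σ-zeros n (λ k _ → cong (_* g (n ∸ k)) (NP.*-zeroʳ (n C k)))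

  ⋆-zeroʳ : ∀ n (f : ℕ → ℕ) → (f ⋆ (λ _ → 0)) n ≡ 0
  ⋆-zeroʳ n f = ΣN.Σ-zeros n (λ k _ → NP.*-zeroʳ ((n C k) * f k))

  S2-col : ℕ → ℕ → ℕ
  S2-col r k = S2 k r

  S2-col⁻ : ℕ → ℕ → ℕ
  S2-col⁻ zero    k = 0
  S2-col⁻ (suc r) k = S2 k r

  S2-col-suc : ∀ r k → S2-col r (suc k) ≡ r * S2-col r k + S2-col⁻ r k
  S2-col-suc zero    k = refl
  S2-col-suc (suc r) k = refl

  k<r⇒S2≡0 : ∀ {k r} → k < r → S2 k r ≡ 0
  k<r⇒S2≡0 {zero}  {suc r} _         = refl
  k<r⇒S2≡0 {suc k} {suc r} (s≤s k<r) = begin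
    suc r * S2 k (suc r) + S2 k r ≡⟨ cong₂ (λ x y → suc r * x + y) (k<r⇒S2≡0 (NP.m<n⇒m<1+n k<r)) (k<r⇒S2≡0 k<r) ⟩
    suc r * 0 + 0                 ≡⟨ cong (_+ 0) (NP.*-zeroʳ (suc r)) ⟩
    0                             ∎
    where open ≡-Reasoning

  ConvolutionIdentity : ℕ → ℕ → ℕ → Set
  ConvolutionIdentity n r j = (S2-col r ⋆ S2-col j) n ≡ ((r + j) C r) * S2 n (r + j)

  S2-col⁻-⋆ : ∀ n → (∀ r j → ConvolutionIdentity n r j) → ∀ r j →
              (S2-col⁻ r ⋆ S2-col j) n + (S2-col r ⋆ S2-col⁻ j) n ≡ ((r + j) C r) * S2-col⁻ (r + j) n
  S2-col⁻-⋆ n ih zero    zero    = cong₂ _+_ (⋆-zeroˡ n (S2-col 0)) (⋆-zeroʳ n (S2-col 0))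
  S2-col⁻-⋆ n ih zero    (suc j) = cong₂ _+_ (⋆-zeroˡ n (S2-col (suc j))) (ih 0 j)
  S2-col⁻-⋆ n ih (suc r) zero    = begin
    (S2-col r ⋆ S2-col 0) n + (S2-col (suc r) ⋆ (λ _ → 0)) n
      ≡⟨ cong₂ _+_ (ih r 0) (⋆-zeroʳ n (S2-col (suc r))) ⟩
    ((r + 0) C r) * S2 n (r + 0) + 0
      ≡⟨ NP.+-identityʳ _ ⟩
    ((r + 0) C r) * S2 n (r + 0)
      ≡⟨ cong (λ m → (m C r) * S2 n m) (NP.+-identityʳ r) ⟩
    (r C r) * S2 n r
      ≡⟨ cong (_* S2 n r) (trans (nCn≡1 r) (sym (nCn≡1 (suc r)))) ⟩
    (suc r C suc r) * S2 n r
      ≡⟨ cong (λ m → (suc m C suc r) * S2 n m) (sym (NP.+-identityʳ r)) ⟩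
    (suc (r + 0) C suc r) * S2 n (r + 0) ∎
    where open ≡-Reasoning
  S2-col⁻-⋆ n ih (suc r) (suc j) = begin
    (S2-col r ⋆ S2-col (suc j)) n + (S2-col (suc r) ⋆ S2-col j) n
      ≡⟨ cong₂ _+_ (ih r (suc j)) (ih (suc r) j) ⟩
    ((r + suc j) C r) * S2 n (r + suc j) + (suc (r + j) C suc r) * S2 n (suc r + j)
      ≡⟨ cong (λ m → (m C r) * S2 n m + (suc (r + j) C suc r) * S2 n (suc (r + j))) (NP.+-suc r j) ⟩
    (suc (r + j) C r) * S2 n m + (suc (r + j) C suc r) * S2 n m
      ≡⟨ sym (NP.*-distribʳ-+ (S2 n m) (suc (r + j) C r) _) ⟩
    (suc (r + j) C r + suc (r + j) C suc r) * S2 n m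
      ≡⟨ cong (_* S2 n m) (nCk+nC[k+1]≡[n+1]C[k+1] (suc (r + j)) r) ⟩
    (suc (suc (r + j)) C suc r) * S2 n m
      ≡⟨ cong (λ m′ → (suc m′ C suc r) * S2 n m′) (sym (NP.+-suc r j)) ⟩
    (suc (r + suc j) C suc r) * S2 n (r + suc j) ∎
    where
    open ≡-Reasoning
    m : ℕ
    m = suc (r + j)

  S2-col-⋆ : ∀ n r j → ConvolutionIdentity n r j
  S2-col-⋆ zero    zero    zero    = refl
  S2-col-⋆ zero    zero    (suc j) = refl
  S2-col-⋆ zero    (suc r) j       = sym (NP.*-zeroʳ ((suc r + j) C suc r))
  S2-col-⋆ (suc n) r j = begin
    (S2-col r ⋆ S2-col j) (suc n)
      ≡⟨ ⋆-leibniz n (S2-col r) (S2-col j) ⟩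
    ((S2-col r ∘ suc) ⋆ S2-col j) n + (S2-col r ⋆ (S2-col j ∘ suc)) n
      ≡⟨ cong₂ _+_ (trans (⋆-cong n {g = S2-col j} (S2-col-suc r) (λ _ → refl)) (⋆-linearˡ n r (S2-col r) (S2-col⁻ r) (S2-col j)))
                   (trans (⋆-cong n {f = S2-col r} (λ _ → refl) (S2-col-suc j)) (⋆-linearʳ n j (S2-col r) (S2-col j) (S2-col⁻ j))) ⟩
    (r * u + v) + (j * u + w)
      ≡⟨ solve 5 (λ r j u v w → (r :* u :+ v) :+ (j :* u :+ w) := (r :+ j) :* u :+ (v :+ w)) refl r j u v w ⟩
    (r + j) * u + (v + w)
      ≡⟨ cong₂ _+_ (cong ((r + j) *_) (S2-col-⋆ n r j)) (S2-col⁻-⋆ n (S2-col-⋆ n) r j) ⟩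
    (r + j) * (c * S2 n (r + j)) + c * S2-col⁻ (r + j) n
      ≡⟨ solve 4 (λ m c s p → m :* (c :* s) :+ c :* p := c :* (m :* s :+ p)) refl (r + j) c (S2 n (r + j)) _ ⟩
    c * ((r + j) * S2 n (r + j) + S2-col⁻ (r + j) n)
      ≡⟨ cong (c *_) (sym (S2-col-suc (r + j) n)) ⟩
    c * S2 (suc n) (r + j) ∎
    where
    open ≡-Reasoning
    u v w c : ℕ
    u = (S2-col r ⋆ S2-col j) n
    v = (S2-col⁻ r ⋆ S2-col j) n
    w = (S2-col r ⋆ S2-col⁻ j) n
    c = (r + j) C r

open StirlingConvolution using (_⋆_; S2-col; S2-col-⋆; k<r⇒S2≡0)

open import Data.Nat using (_+_)
open import Data.Integer using (ℤ; +_; _*_)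
import Data.Integer as Z
import Data.Integer.Properties as ZP

module ΣZ = SumTo ZP.+-*-commutativeSemiring

pos-sumℕ : ∀ n (f : ℕ → ℕ) → + sumℕ n f ≡ sumℤ n (λ k → + f k)
pos-sumℕ zero    f = refl
pos-sumℕ (suc n) f = trans (ZP.pos-+ (sumℕ n f) (f (suc n))) (cong (Z._+ + f (suc n)) (pos-sumℕ n f))

pos-*-assoc : ∀ a b (x : ℤ) → + a * (+ b * x) ≡ + (a *ℕ b) * x
pos-*-assoc a b x = trans (sym (ZP.*-assoc (+ a) (+ b) x)) (cong (_* x) (sym (ZP.pos-* a b)))

dkr-< : ∀ {k r} → k < r → dkr k r ≡ + 0
dkr-< {k} {r} k<r with r ≤ᵇ k in r≤ᵇk
... | true  = ⊥-elim (NP.<⇒≱ k<r (NP.≤ᵇ⇒≤ r k (subst T (sym r≤ᵇk) tt)))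
... | false = refl

dkr-≥ : ∀ {k r} → r ≤ k → dkr k r ≡ + (k C r) * derangeℤ (k ∸ r)
dkr-≥ {k} {r} r≤k with r ≤ᵇ k in r≤ᵇk
... | true rewrite r≤ᵇk = refl
... | false = ⊥-elim (subst T r≤ᵇk (NP.≤⇒≤ᵇ r≤k))

dkr-+ : ∀ r j → dkr (r + j) r ≡ + ((r + j) C r) * derangeℤ j
dkr-+ r j = trans (dkr-≥ (NP.m≤m+n r j)) (cong (λ m → + ((r + j) C r) * derangeℤ m) (NP.m+n∸m≡n r j))

sumFromTo≡sumℤ : ∀ r n (f : ℕ → ℤ) → (∀ k → k < r → f k ≡ + 0) → sumFromTo r n f ≡ sumℤ n f
sumFromTo≡sumℤ r n f f≡0 with r ≤ᵇ n in r≤ᵇn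
... | true  = begin
  sumℤ (n ∸ r) (λ j → f (r + j)) ≡⟨ ΣZ.Σ-dropˡ r (n ∸ r) f f≡0 ⟨
  sumℤ (r + (n ∸ r)) f           ≡⟨ cong (λ m → sumℤ m f) (NP.m+[n∸m]≡n (NP.≤ᵇ⇒≤ r n (subst T (sym r≤ᵇn) tt))) ⟩
  sumℤ n f                       ∎
  where open ≡-Reasoning
... | false = sym (ΣZ.Σ-zeros n (λ k k≤n → f≡0 k (NP.≤-<-trans k≤n n<r)))
  where
  n<r : n < r
  n<r = NP.≰⇒> (λ r≤n → subst T r≤ᵇn (NP.≤⇒≤ᵇ r≤n))

stirlingDerangementSum : ℕ → ℕ → ℤ
stirlingDerangementSum n r = sumℤ n (λ j → + (S2-col r ⋆ S2-col j) n * derangeℤ j)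

wPartial≡stirlingDerangementSum : ∀ n r → wPartial n r ≡ stirlingDerangementSum n r
wPartial≡stirlingDerangementSum n r = begin
  sumℤ n term                 ≡⟨ ΣZ.Σ-dropʳ r n term (λ k n<k → cong (λ s → + s * dkr k r) (k<r⇒S2≡0 n<k)) ⟨
  sumℤ (r + n) term           ≡⟨ ΣZ.Σ-dropˡ r n term (λ k k<r → trans (cong (+ S2 n k *_) (dkr-< k<r)) (ZP.*-zeroʳ (+ S2 n k))) ⟩
  sumℤ n (λ j → term (r + j)) ≡⟨ ΣZ.Σ-cong n (λ j _ → regroup j) ⟩
  stirlingDerangementSum n r  ∎
  where
  open ≡-Reasoning
  term : ℕ → ℤ
  term k = + S2 n k * dkr k r
  regroup : ∀ j → term (r + j) ≡ + (S2-col r ⋆ S2-col j) n * derangeℤ j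
  regroup j = begin
    + S2 n (r + j) * dkr (r + j) r                    ≡⟨ cong (+ S2 n (r + j) *_) (dkr-+ r j) ⟩
    + S2 n (r + j) * (+ ((r + j) C r) * derangeℤ j)   ≡⟨ pos-*-assoc (S2 n (r + j)) _ _ ⟩
    + (S2 n (r + j) *ℕ ((r + j) C r)) * derangeℤ j    ≡⟨ cong (λ s → + s * derangeℤ j) (NP.*-comm (S2 n (r + j)) _) ⟩
    + (((r + j) C r) *ℕ S2 n (r + j)) * derangeℤ j    ≡⟨ cong (λ s → + s * derangeℤ j) (S2-col-⋆ n r j) ⟨
    + (S2-col r ⋆ S2-col j) n * derangeℤ j            ∎

wTerm : ℕ → ℕ → ℕ → ℤ
wTerm n r k = + ((n C k) *ℕ S2 k r) * wDeranged (n ∸ k)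

wTerm-expand : ∀ n r k → k ≤ n →
               wTerm n r k ≡ sumℤ n (λ j → + ((n C k) *ℕ S2 k r *ℕ S2 (n ∸ k) j) * derangeℤ j)
wTerm-expand n r k k≤n = begin
  + c * sumℤ (n ∸ k) term        ≡⟨ cong (+ c *_) (ΣZ.Σ-dropʳ k (n ∸ k) term
                                      (λ j n∸k<j → cong (λ s → + s * dkr j 0) (k<r⇒S2≡0 n∸k<j))) ⟨
  + c * sumℤ (k + (n ∸ k)) term  ≡⟨ cong (λ m → + c * sumℤ m term) (NP.m+[n∸m]≡n k≤n) ⟩
  + c * sumℤ n term              ≡⟨ ΣZ.*-distribˡ-Σ n (+ c) term ⟩
  sumℤ n (λ j → + c * term j)    ≡⟨ ΣZ.Σ-cong n (λ j _ → trans (pos-*-assoc c _ _)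
                                      (cong (+ (c *ℕ S2 (n ∸ k) j) *_) (ZP.*-identityˡ (derangeℤ j)))) ⟩
  sumℤ n (λ j → + (c *ℕ S2 (n ∸ k) j) * derangeℤ j) ∎
  where
  open ≡-Reasoning
  c : ℕ
  c = (n C k) *ℕ S2 k r
  term : ℕ → ℤ
  term j = + S2 (n ∸ k) j * dkr j 0

sumFromTo-wTerm≡stirlingDerangementSum : ∀ n r → sumFromTo r n (wTerm n r) ≡ stirlingDerangementSum n r
sumFromTo-wTerm≡stirlingDerangementSum n r = begin
  sumFromTo r n (wTerm n r)                          ≡⟨ sumFromTo≡sumℤ r n (wTerm n r) wTerm-vanishes ⟩
  sumℤ n (wTerm n r)                                 ≡⟨ ΣZ.Σ-cong n (wTerm-expand n r) ⟩
  sumℤ n (λ k → sumℤ n (λ j → + a k j * derangeℤ j)) ≡⟨ ΣZ.Σ-swap n n (λ k j → + a k j * derangeℤ j) ⟩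
  sumℤ n (λ j → sumℤ n (λ k → + a k j * derangeℤ j)) ≡⟨ ΣZ.Σ-cong n (λ j _ → ΣZ.*-distribʳ-Σ n (derangeℤ j) (λ k → + a k j)) ⟨
  sumℤ n (λ j → sumℤ n (λ k → + a k j) * derangeℤ j) ≡⟨ ΣZ.Σ-cong n (λ j _ → cong (_* derangeℤ j) (pos-sumℕ n (λ k → a k j))) ⟨
  stirlingDerangementSum n r                         ∎
  where
  open ≡-Reasoning
  a : ℕ → ℕ → ℕ
  a k j = (n C k) *ℕ S2 k r *ℕ S2 (n ∸ k) j
  wTerm-vanishes : ∀ k → k < r → wTerm n r k ≡ + 0
  wTerm-vanishes k k<r = begin
    + ((n C k) *ℕ S2 k r) * wDeranged (n ∸ k) ≡⟨ cong (λ s → + ((n C k) *ℕ s) * wDeranged (n ∸ k)) (k<r⇒S2≡0 k<r) ⟩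
    + ((n C k) *ℕ 0) * wDeranged (n ∸ k)      ≡⟨ cong (λ s → + s * wDeranged (n ∸ k)) (NP.*-zeroʳ (n C k)) ⟩
    + 0 * wDeranged (n ∸ k)                   ≡⟨ ZP.*-zeroˡ (wDeranged (n ∸ k)) ⟩
    + 0                                       ∎

mainTheorem2 : (n r : ℕ) →
    wPartial n r ≡ sumFromTo r n (λ k → + ((n C k) *ℕ S2 k r) * wDeranged (n ∸ k))
mainTheorem2 n r =
  trans (wPartial≡stirlingDerangementSum n r) (sym (sumFromTo-wTerm≡stirlingDerangementSum n r))
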